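{- Let $G=(V,E)$ be a finite simple undirected graph, let $k\ge 0$ be an integer, let $lb$ be an integer, and let $c$ be a proper coloring of $G$. If $\theta(G,k)\ge lb$ and there is a vertex $u\in V$ such that $ds_c(u)\le lb-2$, then $\theta(G,k)=\theta(G[V\setminus\{u\}],k)$.
   Context: A (proper) coloring of $G$ is a map $c:V\to \mathbb{Z}$ such that $c(x)\ne c(y)$ whenever $\{x,y\}\in E$. The saturation of $u$ is $ds_c(u)=|\{c(v): v\in N(u)\}|$, where $N(u)=\{w:\{u,w\}\in E\}$. For $S\subseteq V$, $G[S]$ is the induced subgraph; $\omega(H)$ is the size of a largest clique in $H$; and $\theta(G,k)=\min_{S\subseteq V,\ |S|\le k}\omega(G[V\setminus S])$. -}

module Defs where

open import Level using (0ℓ)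
open import Data.Nat using (ℕ; _≤_)
open import Data.Integer as ℤ using (ℤ)
open import Data.Fin using (Fin)
open import Data.Fin.Subset using (Subset; _∈_; _⊆_; _─_; ∣_∣)
open import Data.List using (List; length; map; filter; deduplicate; allFin)
open import Data.Product using (Σ; _×_; ∃)
open import Relation.Nullary using (¬_; Dec)
open import Relation.Binary.PropositionalEquality using (_≡_; _≢_)

record Graph (n : ℕ) : Set₁ where
  field
    Adj       : Fin n → Fin n → Set
    adj?      : ∀ x y → Dec (Adj x y)
    sym       : ∀ {x y} → Adj x y → Adj y x
    irrefl    : ∀ {x} → ¬ Adj x x
open Graph public

module _ {n : ℕ} (G : Graph n) where

  Proper : (Fin n → ℤ) → Set
  Proper c = ∀ x y → Adj G x y → c x ≢ c y

  neighbours : Fin n → List (Fin n)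
  neighbours u = filter (adj? G u) (allFin n)

  ds : (Fin n → ℤ) → Fin n → ℕ
  ds c u = length (deduplicate ℤ._≟_ (map c (neighbours u)))

  IsClique : Subset n → Subset n → Set
  IsClique W K = K ⊆ W × (∀ x y → x ∈ K → y ∈ K → x ≢ y → Adj G x y)

  Omega : Subset n → ℕ → Set
  Omega W w = (Σ (Subset n) λ K → IsClique W K × ∣ K ∣ ≡ w)
            × (∀ K → IsClique W K → ∣ K ∣ ≤ w)

  -- θ(G[W], k) ≡ t :  t = min over S ⊆ W with |S| ≤ k of ω(G[W ∖ S])
  Theta : Subset n → ℕ → ℕ → Set
  Theta W k t = (Σ (Subset n) λ S → S ⊆ W × ∣ S ∣ ≤ k × Omega (W ─ S) t)
              × (∀ S → S ⊆ W → ∣ S ∣ ≤ k → ∀ w → Omega (W ─ S) w → t ≤ w)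

-- A clique through u is coloured injectively by a proper colouring, using c u and the
-- colours of N(u); so it has at most 1 + ds(u) ≤ lb - 1 < θ(G,k) vertices. Hence no clique
-- of size ≥ θ(G,k) contains u, and deleting u preserves ω(G[V ∖ S]) whenever that is at
-- least θ(G,k): this applies to an optimal S and to every S ⊆ V ∖ {u}.

module Submission where

open import Defs
open import Data.Nat using (ℕ)
open import Data.Integer using (ℤ; +_; _≤_; _-_)
open import Data.Fin using (Fin)
open import Data.Fin.Subset using (⊤; ⁅_⁆; _─_)

open import Data.Empty using (⊥-elim)
open import Data.Fin.Subset using (Subset; inside; outside; _∈_; _∉_; _⊆_; ∣_∣) renaming (⊥ to ∅)
open import Data.Fin.Subset.Properties
  using (∈⊤; ∉⊥; ⊥⊆; ∣⊥∣≡0; ∣p∣≤n; _⊆?_; _∈?_; anySubset?; x∈⁅y⁆⇒x≡y; x∈p∧x∉q⇒x∈p─q;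
         p─q⊆p; ∣p─q∣≤∣p∣; p─q─r≡p─r─q)
import Data.Fin.Properties as Fin
open import Data.Integer using (+≤+; -[1+_])
import Data.Integer as ℤ
import Data.Nat as ℕ
open import Data.List using (List; []; _∷_; length; map; deduplicate)
open import Data.List.Membership.Propositional using () renaming (_∈_ to _∈ˡ_; _─_ to _─ˡ_)
open import Data.List.Membership.Propositional.Properties using (∈-deduplicate⁺; ∈-map⁺; ∈-filter⁺; ∈-allFin)
open import Data.List.Properties using (length-removeAt′)
open import Data.List.Relation.Unary.Any using (here; there; index)
open import Data.Nat using (suc; zero; s≤s; z≤n) renaming (_≤_ to _≤ℕ_)
open import Data.Nat.Properties using (≤-refl; ≤-reflexive; ≤-trans; ≤-antisym; ≤-pred; <⇒≱; m≤n⇒m<n∨m≡n)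
open import Data.Product using (Σ; ∃; _×_; _,_)
open import Data.Sum using (inj₁; inj₂)
open import Data.Vec using ([]; _∷_; here; there)
open import Function using (_∘_)
open import Relation.Nullary using (Dec; yes; no; ¬?)
open import Relation.Nullary.Decidable using (_×-dec_; _→-dec_)
open import Relation.Unary using (Decidable)
open import Relation.Binary.PropositionalEquality using (_≡_; _≢_; refl; cong; subst)
import Relation.Binary.PropositionalEquality as ≡

private
  variable
    n : ℕ

x∈p─q⇒x∉q : ∀ {x : Fin n} (p q : Subset n) → x ∈ p ─ q → x ∉ q
x∈p─q⇒x∉q (_       ∷ p) (_       ∷ q) (there x∈p─q) (there x∈q) = x∈p─q⇒x∉q p q x∈p─q x∈q
x∈p─q⇒x∉q (inside  ∷ p) (inside  ∷ q) ()            here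
x∈p─q⇒x∉q (outside ∷ p) (_       ∷ q) ()            here

p─r─[q─r]≡p─q─r : ∀ (p q r : Subset n) → p ─ r ─ (q ─ r) ≡ p ─ q ─ r
p─r─[q─r]≡p─q─r []      []            []            = refl
p─r─[q─r]≡p─q─r (_ ∷ p) (_       ∷ q) (inside  ∷ r) = cong (outside ∷_) (p─r─[q─r]≡p─q─r p q r)
p─r─[q─r]≡p─q─r (_ ∷ p) (inside  ∷ q) (outside ∷ r) = cong (outside ∷_) (p─r─[q─r]≡p─q─r p q r)
p─r─[q─r]≡p─q─r (x ∷ p) (outside ∷ q) (outside ∷ r) = cong (x ∷_)       (p─r─[q─r]≡p─q─r p q r)

∈-─ : ∀ {A : Set} {w z : A} {ys : List A} (z∈ys : z ∈ˡ ys) → w ∈ˡ ys → w ≢ z → w ∈ˡ ys ─ˡ z∈ys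
∈-─ (here refl) (here refl)  w≢z = ⊥-elim (w≢z refl)
∈-─ (here refl) (there w∈ys) _   = w∈ys
∈-─ (there z∈ys) (here refl) _   = here refl
∈-─ (there z∈ys) (there w∈ys) w≢z = there (∈-─ z∈ys w∈ys w≢z)

pigeonhole-∣p∣≤length : ∀ {A : Set} (p : Subset n) (f : Fin n → A) (ys : List A) →
                        (∀ {x} → x ∈ p → f x ∈ˡ ys) →
                        (∀ {x y} → x ∈ p → y ∈ p → f x ≡ f y → x ≡ y) →
                        ∣ p ∣ ≤ℕ length ys
pigeonhole-∣p∣≤length []            f ys into inj = z≤n
pigeonhole-∣p∣≤length (outside ∷ p) f ys into inj =
  pigeonhole-∣p∣≤length p (f ∘ Fin.suc) ys (into ∘ there)
    (λ x∈p y∈p → Fin.suc-injective ∘ inj (there x∈p) (there y∈p))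
pigeonhole-∣p∣≤length (inside ∷ p) f ys into inj =
  subst (suc ∣ p ∣ ≤ℕ_) (≡.sym (length-removeAt′ ys (index f0∈ys)))
    (s≤s (pigeonhole-∣p∣≤length p (f ∘ Fin.suc) (ys ─ˡ f0∈ys)
      (λ x∈p → ∈-─ f0∈ys (into (there x∈p)) (Fin.0≢1+n ∘ ≡.sym ∘ inj (there x∈p) here))
      (λ x∈p y∈p → Fin.suc-injective ∘ inj (there x∈p) (there y∈p))))
  where
  f0∈ys : f Fin.zero ∈ˡ ys
  f0∈ys = into here

greatest-≤ : ∀ {P : ℕ → Set} → Decidable P → P 0 → ∀ b →
             ∃ λ w → P w × (∀ {m} → P m → m ≤ℕ b → m ≤ℕ w)
greatest-≤ P? P0 zero = 0 , P0 , λ _ m≤0 → m≤0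
greatest-≤ {P} P? P0 (suc b) with P? (suc b) | greatest-≤ P? P0 b
... | yes P[1+b] | _             = suc b , P[1+b] , λ _ m≤1+b → m≤1+b
... | no ¬P[1+b] | w , Pw , below = w , Pw , λ Pm m≤1+b → below Pm (m≤b Pm m≤1+b)
  where
  m≤b : ∀ {m} → P m → m ≤ℕ suc b → m ≤ℕ b
  m≤b Pm m≤1+b with m≤n⇒m<n∨m≡n m≤1+b
  ... | inj₁ m<1+b = ≤-pred m<1+b
  ... | inj₂ refl  = ⊥-elim (¬P[1+b] Pm)

module _ (G : Graph n) where

  IsClique-mono : ∀ {W W′ K} → W ⊆ W′ → IsClique G W K → IsClique G W′ K
  IsClique-mono W⊆W′ (K⊆W , adjacent) = W⊆W′ ∘ K⊆W , adjacent

  IsClique-─ : ∀ {W q K} → (∀ {x} → x ∈ K → x ∉ q) → IsClique G W K → IsClique G (W ─ q) K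
  IsClique-─ disjoint (K⊆W , adjacent) = (λ x∈K → x∈p∧x∉q⇒x∈p─q (K⊆W x∈K) (disjoint x∈K)) , adjacent

  isClique? : ∀ W K → Dec (IsClique G W K)
  isClique? W K = (K ⊆? W) ×-dec Fin.all? λ x → Fin.all? λ y →
    (x ∈? K) →-dec (y ∈? K) →-dec ¬? (x Fin.≟ y) →-dec adj? G x y

  ω-exists : ∀ W → ∃ (Omega G W)
  ω-exists W with greatest-≤ (λ m → anySubset? λ K → isClique? W K ×-dec (∣ K ∣ ℕ.≟ m))
                             (∅ , (⊥⊆ , λ _ _ x∈⊥ → ⊥-elim (∉⊥ x∈⊥)) , ∣⊥∣≡0 n) n
  ... | w , largest , below = w , largest , λ K clique → below (K , clique , refl) (∣p∣≤n K)

  Omega-unique : ∀ {W w w′} → Omega G W w → Omega G W w′ → w ≡ w′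
  Omega-unique ((K , clique , ∣K∣≡w) , below) ((K′ , clique′ , ∣K′∣≡w′) , below′) =
    ≤-antisym (subst (_≤ℕ _) ∣K∣≡w (below′ K clique)) (subst (_≤ℕ _) ∣K′∣≡w′ (below K′ clique′))

  Omega-─ : ∀ {W q w} → Omega G W w →
            (∀ {K} → IsClique G W K → w ≤ℕ ∣ K ∣ → ∀ {x} → x ∈ K → x ∉ q) →
            Omega G (W ─ q) w
  Omega-─ {W} {q} ((K , clique , ∣K∣≡w) , below) avoids =
    (K , IsClique-─ (avoids clique (≤-reflexive (≡.sym ∣K∣≡w))) clique , ∣K∣≡w) ,
    λ K′ clique′ → below K′ (IsClique-mono (p─q⊆p W q) clique′)

  clique-size≤1+ds : ∀ {c W K u} → Proper G c → IsClique G W K → u ∈ K → ∣ K ∣ ≤ℕ suc (ds G c u)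
  clique-size≤1+ds {c} {_} {K} {u} proper (_ , adjacent) u∈K =
    pigeonhole-∣p∣≤length K c (c u ∷ deduplicate ℤ._≟_ (map c (neighbours G u))) colour∈ injective
    where
    colour∈ : ∀ {x} → x ∈ K → c x ∈ˡ c u ∷ deduplicate ℤ._≟_ (map c (neighbours G u))
    colour∈ {x} x∈K with x Fin.≟ u
    ... | yes refl = here refl
    ... | no x≢u = there (∈-deduplicate⁺ ℤ._≟_ (∈-map⁺ c
                     (∈-filter⁺ (adj? G u) (∈-allFin x) (adjacent u x u∈K x∈K (x≢u ∘ ≡.sym)))))
    injective : ∀ {x y} → x ∈ K → y ∈ K → c x ≡ c y → x ≡ y
    injective {x} {y} x∈K y∈K cx≡cy with x Fin.≟ y
    ... | yes x≡y = x≡y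
    ... | no x≢y = ⊥-elim (proper x y (adjacent x y x∈K y∈K x≢y) cx≡cy)

2+d≤t : ∀ {d t} lb → + d ≤ lb - + 2 → lb ≤ + t → 2 ℕ.+ d ≤ℕ t
2+d≤t -[1+ _ ]         ()        _
2+d≤t (+ 0)            ()        _
2+d≤t (+ 1)            ()        _
2+d≤t (+ suc (suc m)) (+≤+ d≤m) (+≤+ 2+m≤t) = ≤-trans (s≤s (s≤s d≤m)) 2+m≤t

lemma4 : ∀ {n : ℕ} (G : Graph n) (k : ℕ) (lb : ℤ) (c : Fin n → ℤ) → Proper G c
       → (t : ℕ) → Theta G ⊤ k t → lb ≤ + t
       → (u : Fin n) → + ds G c u ≤ lb - + 2
       → Theta G (⊤ ─ ⁅ u ⁆) k t
lemma4 G k lb c proper t ((S , _ , ∣S∣≤k , ωS) , minimal) lb≤t u ds≤lb-2 = attained , lower-bound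
  where
  large-cliques-avoid-u : ∀ {W K} → IsClique G W K → t ≤ℕ ∣ K ∣ → ∀ {x} → x ∈ K → x ∉ ⁅ u ⁆
  large-cliques-avoid-u {K = K} clique t≤∣K∣ x∈K x∈⁅u⁆ =
    <⇒≱ (≤-trans (s≤s (clique-size≤1+ds G proper clique (subst (_∈ K) (x∈⁅y⁆⇒x≡y u x∈⁅u⁆) x∈K)))
                 (2+d≤t lb ds≤lb-2 lb≤t))
        t≤∣K∣

  Omega-─⁅u⁆ : ∀ {W w} → Omega G W w → t ≤ℕ w → Omega G (W ─ ⁅ u ⁆) w
  Omega-─⁅u⁆ ω t≤w = Omega-─ G ω λ clique w≤∣K∣ → large-cliques-avoid-u clique (≤-trans t≤w w≤∣K∣)

  attained : Σ (Subset _) λ S′ → S′ ⊆ ⊤ ─ ⁅ u ⁆ × ∣ S′ ∣ ≤ℕ k × Omega G (⊤ ─ ⁅ u ⁆ ─ S′) t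
  attained = S ─ ⁅ u ⁆ , (λ x∈S─u → x∈p∧x∉q⇒x∈p─q ∈⊤ (x∈p─q⇒x∉q S ⁅ u ⁆ x∈S─u)) ,
             ≤-trans (∣p─q∣≤∣p∣ S ⁅ u ⁆) ∣S∣≤k ,
             subst (λ W → Omega G W t) (≡.sym (p─r─[q─r]≡p─q─r ⊤ S ⁅ u ⁆)) (Omega-─⁅u⁆ ωS ≤-refl)

  lower-bound : ∀ S′ → S′ ⊆ ⊤ ─ ⁅ u ⁆ → ∣ S′ ∣ ≤ℕ k → ∀ w → Omega G (⊤ ─ ⁅ u ⁆ ─ S′) w → t ≤ℕ w
  lower-bound S′ _ ∣S′∣≤k w ω with ω-exists G (⊤ ─ S′)
  ... | w′ , ω′ = subst (t ≤ℕ_) (Omega-unique G ω″ ω) t≤w′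
    where
    t≤w′ : t ≤ℕ w′
    t≤w′ = minimal S′ (λ _ → ∈⊤) ∣S′∣≤k w′ ω′
    ω″ : Omega G (⊤ ─ ⁅ u ⁆ ─ S′) w′
    ω″ = subst (λ W → Omega G W w′) (p─q─r≡p─r─q ⊤ S′ ⁅ u ⁆) (Omega-─⁅u⁆ ω′ t≤w′)
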